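{- Let $G$ be an ordered abelian group, $n \geq 2$ an integer and $a, b \in G$. Then (1) $\mathfrak{s}_n(-a) = \mathfrak{s}_n(a)$ and $\mathfrak{t}_n(-a) = \mathfrak{t}_n(a)$; (2) $\mathfrak{s}_n(a+b) \leq \max\{\mathfrak{s}_n(a), \mathfrak{s}_n(b)\}$ and $\mathfrak{t}_n(a+b) \leq \max\{\mathfrak{t}_n(a), \mathfrak{t}_n(b)\}$.
   Context: Convex subgroups of $G$ are linearly ordered by inclusion, with $\emptyset$ considered smaller than every convex subgroup. For $n\ge2$, $a\in G$: if $a\notin nG$, $\mathfrak{s}_n(a)$ is the largest convex subgroup $H$ of $G$ with $a\notin H+nG$; if $a \in nG$, $\mathfrak{s}_n(a)=\emptyset$. $\mathcal{S}_n=\{\mathfrak{s}_n(a)\mid a\in G\}$ and $\mathfrak{t}_n(a)=\bigcup_{H\in\mathcal{S}_n,\, a\notin H}H$. -}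

module Defs where

open import Level using (Level; _⊔_; suc)
open import Data.Nat using (ℕ)
open import Data.Product using (Σ; ∃; _×_; _,_)
open import Data.Sum using (_⊎_)
open import Relation.Nullary using (¬_)
open import Relation.Unary using (Pred; _⊆_)
open import Relation.Binary.Structures using (IsTotalOrder)
open import Algebra.Bundles using (AbelianGroup)
import Algebra.Definitions.RawMonoid as RawMonoidDefs

record OrderedAbelianGroup (c ℓ₁ ℓ₂ : Level) : Set (suc (c ⊔ ℓ₁ ⊔ ℓ₂)) where
  field
    abelianGroup : AbelianGroup c ℓ₁
  open AbelianGroup abelianGroup public
    renaming (_∙_ to _+_; ε to 0#; _⁻¹ to -_)
  field
    _≤_         : Carrier → Carrier → Set ℓ₂
    isTotalOrder : IsTotalOrder _≈_ _≤_
    +-mono-≤    : ∀ {a b} c → a ≤ b → (a + c) ≤ (b + c)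

module OAG {c ℓ₁ ℓ₂} (G : OrderedAbelianGroup c ℓ₁ ℓ₂) where
  open OrderedAbelianGroup G public

  _·_ : ℕ → Carrier → Carrier
  n · g = RawMonoidDefs._×_ rawMonoid n g

  Subset : Set (suc (c ⊔ ℓ₁ ⊔ ℓ₂))
  Subset = Pred Carrier (c ⊔ ℓ₁ ⊔ ℓ₂)

  record IsSubgroup (H : Subset) : Set (c ⊔ ℓ₁ ⊔ ℓ₂) where
    field
      respects : ∀ {x y} → x ≈ y → H x → H y
      has-0    : H 0#
      closed-+ : ∀ {x y} → H x → H y → H (x + y)
      closed-- : ∀ {x} → H x → H (- x)

  IsConvex : Subset → Set (c ⊔ ℓ₁ ⊔ ℓ₂)
  IsConvex H = ∀ {g h} → H h → 0# ≤ g → g ≤ h → H g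

  IsConvexSubgroup : Subset → Set (c ⊔ ℓ₁ ⊔ ℓ₂)
  IsConvexSubgroup H = IsSubgroup H × IsConvex H

  nG : ℕ → Pred Carrier (c ⊔ ℓ₁)
  nG n x = ∃ λ g → x ≈ (n · g)

  _+nG_ : Subset → ℕ → Subset
  (H +nG n) x = ∃ λ h → ∃ λ g → H h × x ≈ (h + (n · g))

  -- IsS n a S : "S = 𝔰_n(a)".
  -- If a ∈ nG then S is the empty set; otherwise S is the largest
  -- convex subgroup H with a ∉ H + nG.
  record IsS (n : ℕ) (a : Carrier) (S : Subset) : Set (suc (c ⊔ ℓ₁ ⊔ ℓ₂)) where
    field
      case-in  : nG n a → ∀ x → ¬ S x
      case-out : ¬ nG n a →
                 IsConvexSubgroup S × ¬ (S +nG n) a ×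
                 (∀ (H : Subset) → IsConvexSubgroup H → ¬ (H +nG n) a → H ⊆ S)

  -- 𝔱_n(a) = ⋃ { H ∈ 𝒮_n | a ∉ H },  𝒮_n = { 𝔰_n(b) | b ∈ G }
  t : ℕ → Carrier → Pred Carrier (suc (c ⊔ ℓ₁ ⊔ ℓ₂))
  t n a x = ∃ λ b → Σ Subset λ H → IsS n b H × ¬ H a × H x

module Submission where

-- For 𝔰ₙ both parts follow from maximality: H + nG is a subgroup, so it contains -a iff it contains a,
-- and if it misses a + b it misses a or b.  For 𝔱ₙ, part (1) holds because subgroups are closed under
-- negation; for part (2), any two convex subgroups are comparable, so if some 𝔰ₙ(c) contains a but not b,
-- every convex subgroup avoiding a + b lies in it and thus avoids b; otherwise every 𝔰ₙ(c) containing a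
-- also contains b, hence a + b, so a subgroup avoiding a + b avoids a.

open import Defs
open import Data.Nat using (ℕ; _≤_; zero; suc)
open import Data.Product using (_×_; ∃; Σ; _,_; proj₁)
open import Data.Sum using (_⊎_; inj₁; inj₂)
open import Data.Empty using (⊥-elim)
open import Function using (_∘_)
open import Relation.Nullary using (¬_; yes; no)
open import Relation.Nullary.Decidable using (decidable-stable)
open import Relation.Unary using (_⊆_; _≐_)
open import Relation.Binary.Structures using (IsTotalOrder)
open import Axiom.ExcludedMiddle using (ExcludedMiddle)

module OrderedAbelianGroupProperties {c ℓ₁ ℓ₂} (G : OrderedAbelianGroup c ℓ₁ ℓ₂) where
  open OAG G hiding (_-_) renaming (_≤_ to _≤ᴳ_)
  open import Algebra.Properties.AbelianGroup abelianGroup using (⁻¹-∙-comm)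
  open import Algebra.Properties.Group group using (ε⁻¹≈ε; ⁻¹-involutive)
  open import Algebra.Properties.CommutativeSemigroup commutativeSemigroup using (interchange)
  open import Algebra.Properties.CommutativeMonoid.Mult commutativeMonoid using (×-distrib-+)
  open IsTotalOrder isTotalOrder using (total; ≤-respˡ-≈; ≤-respʳ-≈)
  open IsSubgroup

  ·-neg : ∀ m g → m · (- g) ≈ - (m · g)
  ·-neg zero    g = sym ε⁻¹≈ε
  ·-neg (suc m) g = trans (∙-congˡ (·-neg m g)) (⁻¹-∙-comm g (m · g))

  _≈±_ : Carrier → Carrier → Set ℓ₁
  y ≈± x = y ≈ x ⊎ y ≈ - x

  ∃-nonneg-≈± : ∀ x → ∃ λ y → 0# ≤ᴳ y × y ≈± x
  ∃-nonneg-≈± x with total 0# x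
  ... | inj₁ 0≤x = x , 0≤x , inj₁ refl
  ... | inj₂ x≤0 = - x , ≤-respʳ-≈ (identityˡ (- x)) (≤-respˡ-≈ (inverseʳ x) (+-mono-≤ (- x) x≤0)) , inj₂ refl

  module _ {H : Subset} (H-sub : IsSubgroup H) where
    ∈-neg⁻ : ∀ {x} → H (- x) → H x
    ∈-neg⁻ H-x = respects H-sub (⁻¹-involutive _) (closed-- H-sub H-x)

    ∈-≈± : ∀ {x y} → y ≈± x → H x → H y
    ∈-≈± (inj₁ y≈x)  Hx = respects H-sub (sym y≈x) Hx
    ∈-≈± (inj₂ y≈-x) Hx = respects H-sub (sym y≈-x) (closed-- H-sub Hx)

    ∈-≈±⁻ : ∀ {x y} → y ≈± x → H y → H x
    ∈-≈±⁻ (inj₁ y≈x)  Hy = respects H-sub y≈x Hy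
    ∈-≈±⁻ (inj₂ y≈-x) Hy = ∈-neg⁻ (respects H-sub y≈-x Hy)

  -- Compare the absolute values of the two witnesses and use convexity of the subgroup containing the larger.
  ∌⇒⊆ : ∀ {H K : Subset} → IsConvexSubgroup H → IsConvexSubgroup K →
        ∀ {h} → H h → ¬ K h → K ⊆ H
  ∌⇒⊆ (H-sub , H-convex) (K-sub , K-convex) {h} Hh ¬Kh {k} Kk
    with ∃-nonneg-≈± h | ∃-nonneg-≈± k
  ... | ∣h∣ , 0≤∣h∣ , ∣h∣≈±h | ∣k∣ , 0≤∣k∣ , ∣k∣≈±k with total ∣h∣ ∣k∣
  ... | inj₁ ∣h∣≤∣k∣ =
    ⊥-elim (¬Kh (∈-≈±⁻ K-sub ∣h∣≈±h (K-convex (∈-≈± K-sub ∣k∣≈±k Kk) 0≤∣h∣ ∣h∣≤∣k∣)))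
  ... | inj₂ ∣k∣≤∣h∣ =
    ∈-≈±⁻ H-sub ∣k∣≈±k (H-convex (∈-≈± H-sub ∣h∣≈±h Hh) 0≤∣k∣ ∣k∣≤∣h∣)

  ∉-+⇒∉ : ∀ {H₀ H : Subset} → IsConvexSubgroup H₀ → IsConvexSubgroup H →
          ∀ {a b} → H₀ a → ¬ H₀ b → ¬ H (a + b) → ¬ H b
  ∉-+⇒∉ H₀-convex H-convex@(H-sub , _) H₀a ¬H₀b ¬Hab Hb =
    ¬H₀b (∌⇒⊆ H₀-convex H-convex H₀a (λ Ha → ¬Hab (closed-+ H-sub Ha Hb)) Hb)

  module _ (n : ℕ) where
    +nG-resp : ∀ {H : Subset} {x y} → x ≈ y → (H +nG n) x → (H +nG n) y
    +nG-resp x≈y (h , g , Hh , x≈h+ng) = h , g , Hh , trans (sym x≈y) x≈h+ng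

    module _ {H : Subset} (H-sub : IsSubgroup H) where
      nG⊆+nG : nG n ⊆ (H +nG n)
      nG⊆+nG (g , x≈ng) = 0# , g , has-0 H-sub , trans x≈ng (sym (identityˡ (n · g)))

      +nG-neg : ∀ {x} → (H +nG n) x → (H +nG n) (- x)
      +nG-neg {x} (h , g , Hh , x≈h+ng) = - h , - g , closed-- H-sub Hh , (begin
        - x              ≈⟨ ⁻¹-cong x≈h+ng ⟩
        - (h + n · g)    ≈⟨ ⁻¹-∙-comm h (n · g) ⟨
        - h + - (n · g)  ≈⟨ ∙-congˡ (·-neg n g) ⟨
        - h + n · (- g)  ∎)
        where open import Relation.Binary.Reasoning.Setoid setoid

      +nG-+ : ∀ {x y} → (H +nG n) x → (H +nG n) y → (H +nG n) (x + y)
      +nG-+ {x} {y} (h₁ , g₁ , Hh₁ , x≈) (h₂ , g₂ , Hh₂ , y≈) =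
        h₁ + h₂ , g₁ + g₂ , closed-+ H-sub Hh₁ Hh₂ , (begin
          x + y                          ≈⟨ ∙-cong x≈ y≈ ⟩
          (h₁ + n · g₁) + (h₂ + n · g₂)  ≈⟨ interchange h₁ (n · g₁) h₂ (n · g₂) ⟩
          (h₁ + h₂) + (n · g₁ + n · g₂)  ≈⟨ ∙-congˡ (×-distrib-+ g₁ g₂ n) ⟨
          (h₁ + h₂) + n · (g₁ + g₂)      ∎)
        where open import Relation.Binary.Reasoning.Setoid setoid

    IsS-inhabited : ∀ {a S x} → IsS n a S → S x → IsConvexSubgroup S × ¬ (S +nG n) a
    IsS-inhabited s Sx with IsS.case-out s (λ a∈nG → IsS.case-in s a∈nG _ Sx)
    ... | S-convex , S-avoids , _ = S-convex , S-avoids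

    IsS-subgroup : ∀ {a S x} → IsS n a S → S x → IsSubgroup S
    IsS-subgroup s Sx = proj₁ (proj₁ (IsS-inhabited s Sx))

    IsS-maximal : ∀ {a S H} → IsS n a S → IsConvexSubgroup H → ¬ (H +nG n) a → H ⊆ S
    IsS-maximal s H-convex H-avoids with IsS.case-out s (H-avoids ∘ nG⊆+nG (proj₁ H-convex))
    ... | _ , _ , maximal = maximal _ H-convex H-avoids

    IsS-neg : ∀ {a Sa Sna} → IsS n a Sa → IsS n (- a) Sna → Sna ≐ Sa
    IsS-neg {a} {Sa} {Sna} sa sna = Sna⊆Sa , Sa⊆Sna
      where
      Sna⊆Sa : Sna ⊆ Sa
      Sna⊆Sa Snax with IsS-inhabited sna Snax
      ... | Sna-convex@(Sna-sub , _) , Sna-avoids =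
        IsS-maximal sa Sna-convex (λ r → Sna-avoids (+nG-neg Sna-sub r)) Snax

      Sa⊆Sna : Sa ⊆ Sna
      Sa⊆Sna Sax with IsS-inhabited sa Sax
      ... | Sa-convex@(Sa-sub , _) , Sa-avoids =
        IsS-maximal sna Sa-convex
          (λ r → Sa-avoids (+nG-resp (⁻¹-involutive a) (+nG-neg Sa-sub r))) Sax

    t-neg : ∀ a → t n (- a) ≐ t n a
    t-neg a = (λ { (b , H , s , ¬H-a , Hx) →
                   b , H , s , (λ Ha → ¬H-a (closed-- (IsS-subgroup s Hx) Ha)) , Hx })
            , (λ { (b , H , s , ¬Ha , Hx) →
                   b , H , s , (λ H-a → ¬Ha (∈-neg⁻ (IsS-subgroup s Hx) H-a)) , Hx })

    module Classical (em : ∀ {ℓ} → ExcludedMiddle ℓ) where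
      IsS-+ : ∀ {a b Sa Sb Sab} → IsS n a Sa → IsS n b Sb → IsS n (a + b) Sab →
              (Sab ⊆ Sa) ⊎ (Sab ⊆ Sb)
      IsS-+ {a} {b} {Sab = Sab} sa sb sab with em {P = nG n (a + b)}
      ... | yes a+b∈nG = inj₁ (λ {x} Sabx → ⊥-elim (IsS.case-in sab a+b∈nG x Sabx))
      ... | no a+b∉nG with IsS.case-out sab a+b∉nG
      ... | Sab-convex@(Sab-sub , _) , Sab-avoids , _ with em {P = (Sab +nG n) a}
      ...   | yes ra = inj₂ (IsS-maximal sb Sab-convex (λ rb → Sab-avoids (+nG-+ Sab-sub ra rb)))
      ...   | no ¬ra = inj₁ (IsS-maximal sa Sab-convex ¬ra)

      t-+ : ∀ a b → (t n (a + b) ⊆ t n a) ⊎ (t n (a + b) ⊆ t n b)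
      t-+ a b with em {P = ∃ λ c → Σ Subset λ H → IsS n c H × H a × ¬ H b}
      ... | yes (_ , H₀ , s₀ , H₀a , ¬H₀b) = inj₂ λ { (c , H , s , ¬Hab , Hx) →
        c , H , s , ∉-+⇒∉ (proj₁ (IsS-inhabited s₀ H₀a)) (proj₁ (IsS-inhabited s Hx)) H₀a ¬H₀b ¬Hab , Hx }
      ... | no ∄ = inj₁ λ { (c , H , s , ¬Hab , Hx) →
        let Ha⇒Hb = λ Ha → decidable-stable em (λ ¬Hb → ∄ (c , H , s , Ha , ¬Hb))
        in c , H , s , (λ Ha → ¬Hab (closed-+ (IsS-subgroup s Hx) Ha (Ha⇒Hb Ha))) , Hx }

-- The argument works for every n.
lemma2p5 : (∀ {ℓ} → ExcludedMiddle ℓ) →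
    ∀ {c ℓ₁ ℓ₂} (G : OrderedAbelianGroup c ℓ₁ ℓ₂) (n : ℕ) → 2 ≤ n →
    let open OAG G in
    ∀ (a b : Carrier) →
    (∀ (Sa Sna : Subset) → IsS n a Sa → IsS n (- a) Sna → Sna ≐ Sa)
    × (t n (- a) ≐ t n a)
    × (∀ (Sa Sb Sab : Subset) → IsS n a Sa → IsS n b Sb → IsS n (a + b) Sab →
         (Sab ⊆ Sa) ⊎ (Sab ⊆ Sb))
    × ((t n (a + b) ⊆ t n a) ⊎ (t n (a + b) ⊆ t n b))
lemma2p5 em G n _ a b =
  (λ _ _ → IsS-neg n) , t-neg n a , (λ _ _ _ → IsS-+) , t-+ a b
  where
  open OrderedAbelianGroupProperties G
  open Classical n em
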